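{- Let $r \geq 1$ be an integer and let $b > 1$ be an integer with $\gcd(2,b) = 1$ such that $2^r b^2$ is almost perfect. Then: (i) if $r = 1$, then $8/7 < I(b^2) < 4/3$, and consequently $3 \nmid b$; (ii) if $r > 1$, then $I(b^2) < 8/7$, and consequently $7 \nmid b$.
   Context: $\sigma(x)$ denotes the sum of the positive divisors of $x$, and $I(x) = \sigma(x)/x$ is the abundancy index. A positive integer $y$ is almost perfect if $\sigma(y) = 2y - 1$. -}

module Defs where

open import Data.Nat using (ℕ; zero; suc; _+_; _*_; _∸_; _<_)
open import Data.Product using (_×_)
open import Relation.Binary.PropositionalEquality using (_≡_)
open import Data.Nat.Divisibility using (_∣?_)
open import Data.List using (List; filter)
open import Data.Nat.ListAction using (sum)
open import Data.List.Base using (upTo)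
open import Data.Integer using (+_)
open import Data.Rational using (ℚ; _/_; 0ℚ)

σ : ℕ → ℕ
σ n = sum (filter (λ d → d ∣? n) (Data.List.map suc (upTo n)))

I : ℕ → ℚ
I zero    = 0ℚ
I (suc m) = (+ σ (suc m)) / suc m

AlmostPerfect : ℕ → Set
AlmostPerfect y = 0 < y × σ y ≡ 2 * y ∸ 1

module Submission where

-- Write B = b², s = σ(B) and m = 2^(r+1) - 1.  Since B is odd, every divisor
-- of 2^r·B is 2^i·d with d ∣ B, so σ(2^r·B) = m·σ(B); almost perfection of
-- 2^r·B then reads  m·s + 1 = (m+1)·B,  i.e.  I(B) = ((m+1)B - 1)/(mB).
-- Everything follows from this "balance equation":
--   * I(B) < (m+1)/m ≤ (n+1)/n for every 1 ≤ n ≤ m   (upper bounds 4/3, 8/7);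
--   * for m = 3 and B ≥ 2, I(B) ≥ 7/6 > 8/7           (lower bound);
--   * if p ∣ b then k, kp, kp² divide B = k·p², so I(B) ≥ (1+p+p²)/p², which
--     contradicts the balance equation once p² ≤ m(1+p)  (p = 3, m = 3 and
--     p = 7, m ≥ 7).

open import Defs
open import Data.Nat using (ℕ; zero; suc; _+_; _*_; _∸_; _^_; _≤_; _<_; z≤n; s≤s; >-nonZero)
open import Data.Nat.Properties
open import Data.Nat.Divisibility
  using (_∣_; _∣?_; divides; >⇒∤; ∣-refl; ∣-trans; ∣n⇒∣m*n; *-monoʳ-∣; *-cancelˡ-∣; m∣m*n; 0∣⇒≡0)
open import Data.Nat.Coprimality using (Coprime; coprime-divisor; coprime-+; 1-coprimeTo; gcd≡1⇒coprime)
open import Data.Nat.GCD using (gcd)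
open import Data.Nat.ListAction using (sum)
open import Data.Nat.ListAction.Properties using (sum-++)
open import Data.Nat.Tactic.RingSolver using (solve-∀)
open import Data.List using ([]; _∷_; map; filter; _++_; [_])
open import Data.List.Base using (upTo)
open import Data.List.Properties using (upTo-∷ʳ; map-++; filter-accept; filter-reject)
open import Data.Integer using (+_; +<+) renaming (_*_ to _*ℤ_; _<_ to _<ℤ_)
import Data.Integer.Properties as ℤ
open import Data.Rational using (_/_) renaming (_<_ to _<ℚ_)
open import Data.Rational.Properties using (toℚᵘ-cancel-<; toℚᵘ-fromℚᵘ)
open import Data.Rational.Unnormalised using (mkℚᵘ; *<*)
import Data.Rational.Unnormalised.Properties as ℚᵘ
open import Data.Product using (∃-syntax; _×_; _,_)
open import Data.Sum using (inj₁; inj₂)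
open import Function using (_∘_)
open import Relation.Nullary using (¬_; Dec; yes; no; contradiction)
open import Relation.Binary.PropositionalEquality
  using (_≡_; _≢_; refl; sym; trans; cong; cong₂; subst; subst₂; module ≡-Reasoning)

fraction-< : ∀ n a m c → n * suc c < m * suc a → (+ n / suc a) <ℚ (+ m / suc c)
fraction-< n a m c n*c<m*a = toℚᵘ-cancel-<
  (ℚᵘ.<-respˡ-≃ (ℚᵘ.≃-sym (toℚᵘ-fromℚᵘ (mkℚᵘ (+ n) a)))
    (ℚᵘ.<-respʳ-≃ (ℚᵘ.≃-sym (toℚᵘ-fromℚᵘ (mkℚᵘ (+ m) c))) (*<* cross)))
  where
  cross : (+ n *ℤ + suc c) <ℤ (+ m *ℤ + suc a)
  cross rewrite sym (ℤ.pos-* n (suc c)) | sym (ℤ.pos-* m (suc a)) = +<+ n*c<m*a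

∑< : (ℕ → ℕ) → ℕ → ℕ
∑< f zero    = 0
∑< f (suc K) = ∑< f K + f K

∑<-cong : ∀ {f g} K → (∀ i → f i ≡ g i) → ∑< f K ≡ ∑< g K
∑<-cong zero    f≡g = refl
∑<-cong (suc K) f≡g = cong₂ _+_ (∑<-cong K f≡g) (f≡g K)

∑<-zero : ∀ {f} K → (∀ i → f i ≡ 0) → ∑< f K ≡ 0
∑<-zero zero    f≡0 = refl
∑<-zero (suc K) f≡0 = cong₂ _+_ (∑<-zero K f≡0) (f≡0 K)

∑<-scale : ∀ c f K → ∑< (λ i → c * f i) K ≡ c * ∑< f K
∑<-scale c f zero    = sym (*-zeroʳ c)
∑<-scale c f (suc K) =
  trans (cong (_+ c * f K) (∑<-scale c f K)) (sym (*-distribˡ-+ c (∑< f K) (f K)))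

∑<-parity : ∀ f K → ∑< f (K + K) ≡ ∑< (λ i → f (i + i)) K + ∑< (λ i → f (suc (i + i))) K
∑<-parity f zero    = refl
∑<-parity f (suc K) rewrite +-suc K K =
  trans (cong (λ x → x + f (K + K) + f (suc (K + K))) (∑<-parity f K))
        (interchange (∑< (λ i → f (i + i)) K) (∑< (λ i → f (suc (i + i))) K) (f (K + K)) (f (suc (K + K))))
  where
  interchange : ∀ a b x y → a + b + x + y ≡ (a + x) + (b + y)
  interchange = solve-∀

∑<-extend : ∀ f j K → ∑< f K ≤ ∑< f (j + K)
∑<-extend f zero    K = ≤-refl
∑<-extend f (suc j) K = ≤-trans (∑<-extend f j K) (m≤m+n (∑< f (j + K)) _)

∑<-mono : ∀ f {K L} → K ≤ L → ∑< f K ≤ ∑< f L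
∑<-mono f {K} {L} K≤L = subst (λ x → ∑< f K ≤ ∑< f x) (m∸n+n≡m K≤L) (∑<-extend f (L ∸ K) K)

∑<-three : ∀ f {x y z K} → x < y → y < z → z < K → f x + f y + f z ≤ ∑< f K
∑<-three f {x} {y} {z} {K} x<y y<z z<K = begin
  f x + f y + f z        ≤⟨ +-monoˡ-≤ (f z) (+-monoˡ-≤ (f y)
                              (≤-trans (m≤n+m (f x) (∑< f x)) (∑<-mono f x<y))) ⟩
  ∑< f y + f y + f z     ≤⟨ +-monoˡ-≤ (f z) (∑<-mono f y<z) ⟩
  ∑< f z + f z           ≤⟨ ∑<-mono f z<K ⟩
  ∑< f K                 ∎
  where open ≤-Reasoning

divisorTerm : ℕ → ℕ → ℕ
divisorTerm n d with d ∣? n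
... | yes _ = d
... | no  _ = 0

divisorTerm-∣ : ∀ {n d} → d ∣ n → divisorTerm n d ≡ d
divisorTerm-∣ {n} {d} d∣n with d ∣? n
... | yes _  = refl
... | no d∤n = contradiction d∣n d∤n

divisorTerm-∤ : ∀ {n d} → ¬ d ∣ n → divisorTerm n d ≡ 0
divisorTerm-∤ {n} {d} d∤n with d ∣? n
... | yes d∣n = contradiction d∣n d∤n
... | no  _   = refl

divisorSum : ℕ → ℕ → ℕ
divisorSum n = ∑< (λ i → divisorTerm n (suc i))

filter-divisors : ∀ n xs →
  sum (filter (_∣? n) (map suc xs)) ≡ sum (map (λ i → divisorTerm n (suc i)) xs)
filter-divisors n []       = refl
filter-divisors n (x ∷ xs) = by-cases (suc x ∣? n)
  where
  by-cases : Dec (suc x ∣ n) →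
    sum (filter (_∣? n) (map suc (x ∷ xs))) ≡ sum (map (λ i → divisorTerm n (suc i)) (x ∷ xs))
  by-cases (yes d∣n) = trans (cong sum (filter-accept (_∣? n) d∣n))
                             (cong₂ _+_ (sym (divisorTerm-∣ d∣n)) (filter-divisors n xs))
  by-cases (no  d∤n) = trans (cong sum (filter-reject (_∣? n) d∤n))
                             (trans (filter-divisors n xs) (cong (_+ _) (sym (divisorTerm-∤ d∤n))))

sum-upTo : ∀ f K → sum (map f (upTo K)) ≡ ∑< f K
sum-upTo f zero    = refl
sum-upTo f (suc K) = begin
  sum (map f (upTo (suc K)))        ≡⟨ cong (sum ∘ map f) (sym (upTo-∷ʳ K)) ⟩
  sum (map f (upTo K ++ [ K ]))     ≡⟨ cong sum (map-++ f (upTo K) [ K ]) ⟩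
  sum (map f (upTo K) ++ [ f K ])   ≡⟨ sum-++ (map f (upTo K)) [ f K ] ⟩
  sum (map f (upTo K)) + (f K + 0)  ≡⟨ cong₂ _+_ (sum-upTo f K) (+-identityʳ (f K)) ⟩
  ∑< f K + f K                      ∎
  where open ≡-Reasoning

σ≡divisorSum : ∀ n → σ n ≡ divisorSum n n
σ≡divisorSum n = trans (filter-divisors n (upTo n)) (sum-upTo (λ i → divisorTerm n (suc i)) n)

divisorSum-σ : ∀ {n} K → 0 < n → n ≤ K → divisorSum n K ≡ σ n
divisorSum-σ {suc _} zero    _   ()
divisorSum-σ {n}     (suc K) n>0 n≤1+K with m≤n⇒m<n∨m≡n n≤1+K
... | inj₂ refl = sym (σ≡divisorSum n)
... | inj₁ n<1+K = begin
  divisorSum n K + divisorTerm n (suc K)  ≡⟨ cong₂ _+_ (divisorSum-σ K n>0 (≤-pred n<1+K))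
                                                       (divisorTerm-∤ (>⇒∤ {{>-nonZero n>0}} n<1+K)) ⟩
  σ n + 0                                 ≡⟨ +-identityʳ (σ n) ⟩
  σ n                                     ∎
  where open ≡-Reasoning

σ-three-divisors : ∀ {n a b c} → 0 < n → a < b → b < c → c ≤ n →
  a ∣ n → b ∣ n → c ∣ n → a + b + c ≤ σ n
σ-three-divisors {n} {zero} n>0 _ _ _ 0∣n _ _ = contradiction (0∣⇒≡0 0∣n) (>⇒≢ n>0)
σ-three-divisors {n} {suc a} {suc b} {suc c} n>0 (s≤s a<b) (s≤s b<c) c<1+n a∣n b∣n c∣n =
  subst₂ _≤_ (cong₂ _+_ (cong₂ _+_ (divisorTerm-∣ a∣n) (divisorTerm-∣ b∣n)) (divisorTerm-∣ c∣n))
             (sym (σ≡divisorSum n))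
             (∑<-three (λ i → divisorTerm n (suc i)) a<b b<c c<1+n)

odd-coprime-2 : ∀ i → Coprime (suc (i + i)) 2
odd-coprime-2 zero    = 1-coprimeTo 2
odd-coprime-2 (suc i) rewrite +-suc i i = coprime-+ (odd-coprime-2 i)

even-index : ∀ i → suc (suc (i + i)) ≡ 2 * suc i
even-index = solve-∀

divisorTerm-double-odd : ∀ n i → divisorTerm (2 * n) (suc (i + i)) ≡ divisorTerm n (suc (i + i))
divisorTerm-double-odd n i = by-cases (suc (i + i) ∣? n)
  where
  by-cases : Dec (suc (i + i) ∣ n) → divisorTerm (2 * n) (suc (i + i)) ≡ divisorTerm n (suc (i + i))
  by-cases (yes d∣n) = trans (divisorTerm-∣ (∣n⇒∣m*n 2 d∣n)) (sym (divisorTerm-∣ d∣n))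
  by-cases (no  d∤n) = trans (divisorTerm-∤ (d∤n ∘ coprime-divisor (odd-coprime-2 i)))
                             (sym (divisorTerm-∤ d∤n))

divisorTerm-double-even : ∀ n i → divisorTerm (2 * n) (suc (suc (i + i))) ≡ 2 * divisorTerm n (suc i)
divisorTerm-double-even n i = trans (cong (divisorTerm (2 * n)) (even-index i)) (by-cases (suc i ∣? n))
  where
  by-cases : Dec (suc i ∣ n) → divisorTerm (2 * n) (2 * suc i) ≡ 2 * divisorTerm n (suc i)
  by-cases (yes d∣n) = trans (divisorTerm-∣ (*-monoʳ-∣ 2 d∣n)) (cong (2 *_) (sym (divisorTerm-∣ d∣n)))
  by-cases (no  d∤n) = trans (divisorTerm-∤ (d∤n ∘ *-cancelˡ-∣ 2))
                             (cong (2 *_) (sym (divisorTerm-∤ d∤n)))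

divisorTerm-odd-even : ∀ {n} i → ¬ 2 ∣ n → divisorTerm n (suc (suc (i + i))) ≡ 0
divisorTerm-odd-even {n} i 2∤n = divisorTerm-∤ (2∤n ∘ ∣-trans 2∣d)
  where
  2∣d : 2 ∣ suc (suc (i + i))
  2∣d = subst (2 ∣_) (sym (even-index i)) (m∣m*n (suc i))

oddDivisorSum : ℕ → ℕ → ℕ
oddDivisorSum n = ∑< (λ i → divisorTerm n (suc (i + i)))

σ-double : ∀ {n} → 0 < n → σ (2 * n) ≡ oddDivisorSum n n + 2 * σ n
σ-double {n} n>0 = begin
  σ (2 * n)                                  ≡⟨ divisorSum-σ (n + n) 2n>0 (≤-reflexive n+[n+0]≡n+n) ⟨
  divisorSum (2 * n) (n + n)                 ≡⟨ ∑<-parity (λ i → divisorTerm (2 * n) (suc i)) n ⟩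
  oddDivisorSum (2 * n) n + ∑< (λ i → divisorTerm (2 * n) (suc (suc (i + i)))) n
                                             ≡⟨ cong₂ _+_ (∑<-cong n (divisorTerm-double-odd n))
                                                          (∑<-cong n (divisorTerm-double-even n)) ⟩
  oddDivisorSum n n + ∑< (λ i → 2 * divisorTerm n (suc i)) n
                                             ≡⟨ cong (_+_ (oddDivisorSum n n)) (∑<-scale 2 _ n) ⟩
  oddDivisorSum n n + 2 * divisorSum n n     ≡⟨ cong (λ x → oddDivisorSum n n + 2 * x) (σ≡divisorSum n) ⟨
  oddDivisorSum n n + 2 * σ n                ∎
  where
  open ≡-Reasoning
  2n>0 : 0 < 2 * n
  2n>0 = ≤-trans n>0 (m≤m+n n _)
  n+[n+0]≡n+n : n + (n + 0) ≡ n + n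
  n+[n+0]≡n+n = cong (_+_ n) (+-identityʳ n)

oddDivisorSum-2^ : ∀ r m K → oddDivisorSum (2 ^ r * m) K ≡ oddDivisorSum m K
oddDivisorSum-2^ zero    m K = cong (λ x → oddDivisorSum x K) (+-identityʳ m)
oddDivisorSum-2^ (suc r) m K = begin
  oddDivisorSum (2 * 2 ^ r * m) K    ≡⟨ cong (λ x → oddDivisorSum x K) (*-assoc 2 (2 ^ r) m) ⟩
  oddDivisorSum (2 * (2 ^ r * m)) K  ≡⟨ ∑<-cong K (divisorTerm-double-odd (2 ^ r * m)) ⟩
  oddDivisorSum (2 ^ r * m) K        ≡⟨ oddDivisorSum-2^ r m K ⟩
  oddDivisorSum m K                  ∎
  where open ≡-Reasoning

oddDivisorSum-odd : ∀ {m} K → ¬ 2 ∣ m → 0 < m → m ≤ K → oddDivisorSum m K ≡ σ m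
oddDivisorSum-odd {m} K 2∤m m>0 m≤K = begin
  oddDivisorSum m K                    ≡⟨ +-identityʳ _ ⟨
  oddDivisorSum m K + 0                ≡⟨ cong (_+_ (oddDivisorSum m K))
                                            (∑<-zero K (λ i → divisorTerm-odd-even i 2∤m)) ⟨
  oddDivisorSum m K + ∑< (λ i → divisorTerm m (suc (suc (i + i)))) K
                                       ≡⟨ ∑<-parity (λ i → divisorTerm m (suc i)) K ⟨
  divisorSum m (K + K)                 ≡⟨ divisorSum-σ (K + K) m>0 (≤-trans m≤K (m≤m+n K K)) ⟩
  σ m                                  ∎
  where open ≡-Reasoning

σ-2^r-odd : ∀ r {m} → ¬ 2 ∣ m → 0 < m → σ (2 ^ r * m) + σ m ≡ 2 ^ suc r * σ m
σ-2^r-odd zero    {m} _   _   = trans (cong (λ x → σ x + σ m) (+-identityʳ m)) (double (σ m))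
  where
  double : ∀ s → s + s ≡ 2 * 1 * s
  double = solve-∀
σ-2^r-odd (suc r) {m} 2∤m m>0 = begin
  σ (2 * 2 ^ r * m) + σ m              ≡⟨ cong (λ x → σ x + σ m) (*-assoc 2 (2 ^ r) m) ⟩
  σ (2 * n) + σ m                      ≡⟨ cong (_+ σ m) (σ-double n>0) ⟩
  oddDivisorSum n n + 2 * σ n + σ m    ≡⟨ cong (λ x → x + 2 * σ n + σ m) odd-part ⟩
  σ m + 2 * σ n + σ m                  ≡⟨ regroup (σ m) (σ n) ⟩
  2 * (σ n + σ m)                      ≡⟨ cong (2 *_) (σ-2^r-odd r 2∤m m>0) ⟩
  2 * (2 ^ suc r * σ m)                ≡⟨ *-assoc 2 (2 ^ suc r) (σ m) ⟨
  2 ^ suc (suc r) * σ m                ∎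
  where
  open ≡-Reasoning
  n = 2 ^ r * m
  m≤n : m ≤ n
  m≤n = m≤n*m m (2 ^ r) {{m^n≢0 2 r}}
  n>0 : 0 < n
  n>0 = ≤-trans m>0 m≤n
  odd-part : oddDivisorSum n n ≡ σ m
  odd-part = trans (oddDivisorSum-2^ r m n) (oddDivisorSum-odd n 2∤m m>0 m≤n)
  regroup : ∀ x y → x + 2 * y + x ≡ 2 * (y + x)
  regroup = solve-∀

mersenne : ℕ → ℕ
mersenne r = 2 ^ suc r ∸ 1

suc-mersenne : ∀ r → suc (mersenne r) ≡ 2 ^ suc r
suc-mersenne r = m+[n∸m]≡n (m^n>0 2 (suc r))

7≤mersenne : ∀ {r} → 1 < r → 7 ≤ mersenne r
7≤mersenne {suc r} (s≤s 1≤r) = ∸-monoˡ-≤ 1 (^-monoʳ-≤ 2 (s≤s (s≤s 1≤r)))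

almostPerfect-balance : ∀ r {B} → ¬ 2 ∣ B → 0 < B → AlmostPerfect (2 ^ r * B) →
  mersenne r * σ B + 1 ≡ suc (mersenne r) * B
almostPerfect-balance r {B} 2∤B B>0 (N>0 , σN≡2N-1) = +-cancelʳ-≡ (σ B) _ _ (begin
  m * s + 1 + s        ≡⟨ rotate (m * s) s ⟩
  suc m * s + 1        ≡⟨ cong (λ x → x * s + 1) (suc-mersenne r) ⟩
  2 ^ suc r * s + 1    ≡⟨ cong (_+ 1) (σ-2^r-odd r 2∤B B>0) ⟨
  σ N + s + 1          ≡⟨ swap-last (σ N) s 1 ⟩
  σ N + 1 + s          ≡⟨ cong (_+ s) σN+1≡mB ⟩
  suc m * B + s        ∎)
  where
  open ≡-Reasoning
  m = mersenne r
  s = σ B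
  N = 2 ^ r * B
  rotate : ∀ x y → x + 1 + y ≡ y + x + 1
  rotate = solve-∀
  swap-last : ∀ x y z → x + y + z ≡ x + z + y
  swap-last = solve-∀
  σN+1≡mB : σ N + 1 ≡ suc m * B
  σN+1≡mB = begin
    σ N + 1            ≡⟨ cong (_+ 1) σN≡2N-1 ⟩
    2 * N ∸ 1 + 1      ≡⟨ m∸n+n≡m (≤-trans N>0 (m≤m+n N _)) ⟩
    2 * N              ≡⟨ *-assoc 2 (2 ^ r) B ⟨
    2 ^ suc r * B      ≡⟨ cong (_* B) (suc-mersenne r) ⟨
    suc m * B          ∎

abundancy-upper : ∀ {m n s B} → 1 ≤ n → n ≤ m → m * s + 1 ≡ suc m * B → s * n < suc n * B
abundancy-upper {m} {n} {s} {B} 1≤n n≤m balance = *-cancelˡ-< m _ _ (begin-strict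
  m * (s * n)           <⟨ m<m+n _ 1≤n ⟩
  m * (s * n) + n       ≡⟨ scale-balance m n s ⟩
  n * (m * s + 1)       ≡⟨ cong (n *_) balance ⟩
  n * (suc m * B)       ≡⟨ expand m n B ⟩
  n * B + m * (n * B)   ≤⟨ +-monoˡ-≤ _ (*-monoˡ-≤ B n≤m) ⟩
  m * B + m * (n * B)   ≡⟨ *-distribˡ-+ m B (n * B) ⟨
  m * (suc n * B)       ∎)
  where
  open ≤-Reasoning
  scale-balance : ∀ m n s → m * (s * n) + n ≡ n * (m * s + 1)
  scale-balance = solve-∀
  expand : ∀ m n B → n * (suc m * B) ≡ n * B + m * (n * B)
  expand = solve-∀

abundancy-lower : ∀ {s B} → 2 ≤ B → 3 * s + 1 ≡ 4 * B → 8 * B < s * 7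
abundancy-lower {s} {B} 2≤B balance = *-cancelˡ-< 3 _ _ (+-cancelʳ-< 7 _ _ (begin-strict
  3 * (8 * B) + 7       <⟨ +-monoʳ-< (3 * (8 * B)) (*-monoʳ-≤ 4 2≤B) ⟩
  3 * (8 * B) + 4 * B   ≡⟨ regroup B ⟩
  7 * (4 * B)           ≡⟨ cong (7 *_) balance ⟨
  7 * (3 * s + 1)       ≡⟨ expand s ⟩
  3 * (s * 7) + 7       ∎))
  where
  open ≤-Reasoning
  regroup : ∀ B → 3 * (8 * B) + 4 * B ≡ 7 * (4 * B)
  regroup = solve-∀
  expand : ∀ s → 7 * (3 * s + 1) ≡ 3 * (s * 7) + 7
  expand = solve-∀

-- If k, kp, kp² all contribute to s, the balance m·s + 1 = (m+1)·kp² is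
-- impossible as soon as p² ≤ m(1+p), since then m·s ≥ (m+1)·kp².
balance-square-factor : ∀ {m s k p} → p * p ≤ m * (1 + p) → k + k * p + k * (p * p) ≤ s →
  m * s + 1 ≢ suc m * (k * (p * p))
balance-square-factor {m} {s} {k} {p} p²≤m[1+p] lower balance = <-irrefl (sym balance) (begin-strict
  suc m * P                     ≡⟨⟩
  P + m * P                     ≤⟨ +-monoˡ-≤ (m * P) P≤m[k+kp] ⟩
  m * (k + k * p) + m * P       ≡⟨ *-distribˡ-+ m (k + k * p) P ⟨
  m * (k + k * p + P)           ≤⟨ *-monoʳ-≤ m lower ⟩
  m * s                         <⟨ m<m+n (m * s) (s≤s z≤n) ⟩
  m * s + 1                     ∎)
  where
  open ≤-Reasoning
  P = k * (p * p)
  rearrange : ∀ m k p → k * (m * (1 + p)) ≡ m * (k + k * p)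
  rearrange = solve-∀
  P≤m[k+kp] : P ≤ m * (k + k * p)
  P≤m[k+kp] = subst (P ≤_) (rearrange m k p) (*-monoʳ-≤ k p²≤m[1+p])

σ-square-factor : ∀ {k p} → 0 < k → 1 < p → k + k * p + k * (p * p) ≤ σ (k * (p * p))
σ-square-factor {k} {p} k>0 p>1 =
  σ-three-divisors n>0 k<kp kp<kpp ≤-refl (m∣m*n (p * p)) kp∣kpp ∣-refl
  where
  instance
    k≢0 = >-nonZero k>0
  k<kp : k < k * p
  k<kp = m<m*n k p p>1
  kp<kpp : k * p < k * (p * p)
  kp<kpp = subst (k * p <_) (*-assoc k p p) (m<m*n (k * p) p {{>-nonZero (<-trans k>0 k<kp)}} p>1)
  kp∣kpp : k * p ∣ k * (p * p)
  kp∣kpp = subst (k * p ∣_) (*-assoc k p p) (m∣m*n p)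
  n>0 : 0 < k * (p * p)
  n>0 = <-trans k>0 (<-trans k<kp kp<kpp)

square-factor : ∀ {b p} → 0 < b → p ∣ b → ∃[ k ] 0 < k × b * b ≡ k * (p * p)
square-factor {b} {p} b>0 (divides q b≡q*p) = q * q , *-mono-< q>0 q>0 , square-product
  where
  q>0 : 0 < q
  q>0 = n≢0⇒n>0 (λ { refl → >⇒≢ b>0 b≡q*p })
  square-product : b * b ≡ q * q * (p * p)
  square-product = trans (cong₂ _*_ b≡q*p b≡q*p) (interchange q p)
    where
    interchange : ∀ q p → q * p * (q * p) ≡ q * q * (p * p)
    interchange = solve-∀

balance-excludes-divisor : ∀ {m b p} → 0 < b → 1 < p → p * p ≤ m * (1 + p) →
  m * σ (b * b) + 1 ≡ suc m * (b * b) → ¬ p ∣ b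
balance-excludes-divisor {m} {b} {p} b>0 p>1 p²≤m[1+p] balance p∣b
  with k , k>0 , b²≡kp² ← square-factor b>0 p∣b =
  balance-square-factor {m} {σ (k * (p * p))} {k} {p} p²≤m[1+p] (σ-square-factor k>0 p>1)
    (subst (λ n → m * σ n + 1 ≡ suc m * n) b²≡kp² balance)

odd-square : ∀ {b} → gcd 2 b ≡ 1 → ¬ 2 ∣ b * b
odd-square {b} gcd≡1 2∣b² = contradiction (coprime (∣-refl , coprime-divisor coprime 2∣b²)) λ ()
  where
  coprime : Coprime 2 b
  coprime = gcd≡1⇒coprime gcd≡1

theorem6 : (r b : ℕ) → 1 ≤ r → 1 < b → gcd 2 b ≡ 1 →
    AlmostPerfect (2 ^ r * (b * b)) →
      (r ≡ 1 → ((+ 8 / 7) <ℚ I (b * b) × I (b * b) <ℚ (+ 4 / 3)) × ¬ (3 ∣ b))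
      × (1 < r → I (b * b) <ℚ (+ 8 / 7) × ¬ (7 ∣ b))
theorem6 r (suc zero) _ (s≤s ()) _ _
theorem6 r b@(suc (suc _)) _ b>1 gcd≡1 almostPerfect = r≡1-case , r>1-case
  where
  B = b * b
  balance : mersenne r * σ B + 1 ≡ suc (mersenne r) * B
  balance = almostPerfect-balance r (odd-square {b} gcd≡1) (s≤s z≤n) almostPerfect
  B≥2 : 2 ≤ B
  B≥2 = ≤-trans b>1 (m≤m*n b b)
  r≡1-case : r ≡ 1 → ((+ 8 / 7) <ℚ I B × I B <ℚ (+ 4 / 3)) × ¬ (3 ∣ b)
  r≡1-case refl =
    ( fraction-< 8 6 (σ B) _ (abundancy-lower {σ B} {B} B≥2 balance)
    , fraction-< (σ B) _ 4 2 (abundancy-upper {3} {3} {σ B} {B} (s≤s z≤n) ≤-refl balance) )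
    , balance-excludes-divisor {3} {b} {3} (s≤s z≤n) (s≤s (s≤s z≤n)) (m≤m+n 9 3) balance
  r>1-case : 1 < r → I B <ℚ (+ 8 / 7) × ¬ (7 ∣ b)
  r>1-case r>1 =
    fraction-< (σ B) _ 8 6 (abundancy-upper {mersenne r} {7} {σ B} {B} (s≤s z≤n) (7≤mersenne r>1) balance)
    , balance-excludes-divisor {mersenne r} {b} {7} (s≤s z≤n) (s≤s (s≤s z≤n))
        (≤-trans (m≤m+n 49 7) (*-monoˡ-≤ 8 (7≤mersenne r>1))) balance
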